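{- Let $p(n)$ denote the number of maximal independent sets of the (ortho) pentagonal cactus $P(n)$. Then $p(1)=5$, $p(2)=13$, $p(3)=42$, $p(4)=127$, and $p(n)=p(n-1)+5p(n-2)+4p(n-3)$ for all $n\ge 5$.
   Context: For $n\ge 1$, the (ortho) pentagonal cactus $P(n)$ is the graph formed by a chain of $n$ 5-cycles $B_1,\dots,B_n$, where for each $1\le i\le n-1$ the consecutive cycles $B_i$ and $B_{i+1}$ share exactly one vertex, non-consecutive cycles share no vertex, every vertex lies in at most two cycles, and for each $2\le i\le n-1$ the two shared (cut) vertices of $B_i$ are adjacent. An independent set is maximal if no further vertex can be added while keeping it independent. -}

module Defs where

open import Data.Nat using (ℕ; zero; suc; _+_; _*_; _≡ᵇ_)
open import Data.Bool using (Bool; true; false; _∧_; _∨_; not)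
open import Data.Fin using (Fin; toℕ)
open import Data.Vec using (Vec; []; _∷_; lookup; _[_]≔_)
open import Data.List using (List; []; _∷_; _++_; map; length; filter; upTo; allFin)
open import Data.Bool.ListAction using (all; any)
open import Data.Fin.Subset using (Subset)
open import Relation.Nullary.Decidable using (does)
open import Data.Bool.Properties using (T?)

-- Cycle B_{i+1} (i = 0,…,n-1) is the 5-cycle
--     4i — 4i+4 — 4i+1 — 4i+2 — 4i+3 — 4i
-- Consecutive cycles B_{i+1}, B_{i+2} share exactly the vertex 4i+4,
-- and for every middle cycle the two cut vertices 4i and 4i+4 are adjacent.

nV : ℕ → ℕ
nV n = 4 * n + 1

sameEdge : ℕ → ℕ → ℕ → ℕ → Bool
sameEdge a b x y = ((a ≡ᵇ x) ∧ (b ≡ᵇ y)) ∨ ((a ≡ᵇ y) ∧ (b ≡ᵇ x))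

inCycle : ℕ → ℕ → ℕ → Bool
inCycle i x y =
  sameEdge (4 * i) (4 * i + 4) x y ∨
  sameEdge (4 * i + 4) (4 * i + 1) x y ∨
  sameEdge (4 * i + 1) (4 * i + 2) x y ∨
  sameEdge (4 * i + 2) (4 * i + 3) x y ∨
  sameEdge (4 * i + 3) (4 * i) x y

adj : (n : ℕ) → Fin (nV n) → Fin (nV n) → Bool
adj n u v = any (λ i → inCycle i (toℕ u) (toℕ v)) (upTo n)

independent : (n : ℕ) → Subset (nV n) → Bool
independent n S =
  all (λ u → all (λ v → not (lookup S u ∧ lookup S v ∧ adj n u v))
                 (allFin (nV n)))
      (allFin (nV n))

maximalIndependent : (n : ℕ) → Subset (nV n) → Bool
maximalIndependent n S =
  independent n S ∧
  all (λ v → lookup S v ∨ not (independent n (S [ v ]≔ true)))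
      (allFin (nV n))

allSubsets : (k : ℕ) → List (Subset k)
allSubsets zero = [] ∷ []
allSubsets (suc k) = map (false ∷_) (allSubsets k) ++ map (true ∷_) (allSubsets k)

p : ℕ → ℕ
p n = length (filter (λ S → T? (maximalIndependent n S)) (allSubsets (nV n)))

-- A set S is maximal independent iff every vertex lies in S or has a neighbour in S, but
-- not both.  This condition is local, so it can be checked one pentagon at a time: P(n+1)
-- is the pentagon 0-4-1-2-3-0 glued at its vertex 4 to a copy of P(n) shifted by 4, and
-- all the copy needs to know is whether its first vertex is in S and whether it already
-- has a neighbour in S among 0 and 1.  Counting by these two bits gives three feasible
-- states a (out, undominated), b (in), c (out, dominated from the left) with
--   a' = 2b + c,   b' = 2c,   c' = a + 2b + c,
-- a system whose characteristic polynomial is x³ − x² − 5x − 4.  Since p = a + b and the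
-- one-vertex graph P(0) has (a, b, c) = (0, 1, 1), both the recurrence and the initial
-- values follow.

module Submission where

open import Defs
open import Data.Bool using (Bool; true; false; _∧_; _∨_; not; _xor_; if_then_else_; T)
open import Data.Bool.Properties using (T?; T-∧; ∧-zeroʳ; ∨-identityʳ; ∨-comm; ∨-assoc; ∧-comm; xor-is-ok)
open import Data.Bool.ListAction using (all; any; or; and)
open import Data.Bool.Solver using (module ∨-∧-Solver)
open import Data.Nat using (ℕ; zero; suc; _+_; _*_; _∸_; _≤_; _<_; _≡ᵇ_; _≤ᵇ_; s≤s; z≤n)
open import Data.Nat.Properties using (*-suc; +-comm; ≤-trans; ≡ᵇ⇒≡; ≡⇒≡ᵇ)
open import Data.List using (List; []; _∷_; _++_; map; length; filter; upTo; applyUpTo; allFin; tabulate)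
open import Data.List.Properties using (map-cong; map-∘; map-applyUpTo; map-upTo; map-tabulate; filter-≐; filter-++; length-++)
open import Data.List.Relation.Unary.Any as Any using ()
open import Data.List.Membership.Propositional using (find; lose)
open import Data.List.Membership.Propositional.Properties using (∈-upTo⁺)
open import Data.List.Relation.Unary.All.Properties as All using (all⁺; all⁻)
open import Data.List.Relation.Unary.Any.Properties as Any using (any⁺; any⁻)
open import Data.Fin as Fin using (Fin; toℕ)
open import Data.Fin.Properties using (_≟_)
open import Data.Fin.Subset using (Subset)
open import Data.Vec as Vec using (lookup; _[_]≔_)
open import Data.Vec.Properties using (lookup∘update; lookup∘update′)
open import Data.Empty using (⊥-elim)
open import Data.Product using (∃; _×_; _,_)
open import Relation.Nullary using (¬_; yes; no)
open import Data.Nat.Tactic.RingSolver using (solve-∀)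
open import Function using (_∘_; id; _⇔_; mk⇔; Equivalence)
open import Relation.Binary.PropositionalEquality using (_≡_; _≢_; refl; sym; trans; cong; cong₂; subst; module ≡-Reasoning)

private variable A B : Set

T-ext : ∀ {a b} → (T a → T b) → (T b → T a) → a ≡ b
T-ext {false} {false} _ _ = refl
T-ext {false} {true}  _ g = ⊥-elim (g _)
T-ext {true}  {false} f _ = ⊥-elim (f _)
T-ext {true}  {true}  _ _ = refl

T-ext-not : ∀ {a b} → (¬ T b → T a) → (T b → ¬ T a) → not a ≡ b
T-ext-not {false} {false} f _ = ⊥-elim (f λ ())
T-ext-not {false} {true}  _ _ = refl
T-ext-not {true}  {false} _ _ = refl
T-ext-not {true}  {true}  _ g = ⊥-elim (g _ _)

∧-assoc₄ : ∀ a b c d r → (a ∧ b ∧ c ∧ d) ∧ r ≡ a ∧ b ∧ c ∧ d ∧ r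
∧-assoc₄ false _     _     _     _ = refl
∧-assoc₄ true  false _     _     _ = refl
∧-assoc₄ true  true  false _     _ = refl
∧-assoc₄ true  true  true  false _ = refl
∧-assoc₄ true  true  true  true  _ = refl

∧-cong-assuming : ∀ a {b c} → (T a → b ≡ c) → a ∧ b ≡ a ∧ c
∧-cong-assuming false _  = refl
∧-cong-assuming true  eq = eq _

any-cong : {p q : A → Bool} → (∀ x → p x ≡ q x) → ∀ xs → any p xs ≡ any q xs
any-cong p≗q xs = cong or (map-cong p≗q xs)

all-cong : {p q : A → Bool} → (∀ x → p x ≡ q x) → ∀ xs → all p xs ≡ all q xs
all-cong p≗q xs = cong and (map-cong p≗q xs)

any-map : ∀ (p : B → Bool) (f : A → B) xs → any p (map f xs) ≡ any (p ∘ f) xs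
any-map p f xs = cong or (sym (map-∘ xs))

any-applyUpTo : ∀ (p : A → Bool) f n → any p (applyUpTo f n) ≡ any (p ∘ f) (upTo n)
any-applyUpTo p f n = cong or (trans (map-applyUpTo f p n) (sym (map-upTo (p ∘ f) n)))

all-applyUpTo : ∀ (p : A → Bool) f n → all p (applyUpTo f n) ≡ all (p ∘ f) (upTo n)
all-applyUpTo p f n = cong and (trans (map-applyUpTo f p n) (sym (map-upTo (p ∘ f) n)))

any-false : ∀ (xs : List A) → any (λ _ → false) xs ≡ false
any-false [] = refl
any-false (_ ∷ xs) = any-false xs

any-∧ˡ : ∀ c (p : A → Bool) xs → any (λ x → c ∧ p x) xs ≡ c ∧ any p xs
any-∧ˡ false p xs = any-false xs
any-∧ˡ true p xs = refl

all-∧ : ∀ (p q : A → Bool) xs → all (λ x → p x ∧ q x) xs ≡ all p xs ∧ all q xs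
all-∧ p q [] = refl
all-∧ p q (x ∷ xs) = trans (cong ((p x ∧ q x) ∧_) (all-∧ p q xs)) (interchange (p x) (q x) _ _)
  where
  open ∨-∧-Solver
  interchange : ∀ a b c d → (a ∧ b) ∧ (c ∧ d) ≡ (a ∧ c) ∧ (b ∧ d)
  interchange = solve 4 (λ a b c d → (a :* b) :* (c :* d) := (a :* c) :* (b :* d)) refl

all-not-∧-any : ∀ c (p : A → Bool) xs → all (λ x → not (c ∧ p x)) xs ≡ not (c ∧ any p xs)
all-not-∧-any c p [] = sym (cong not (∧-zeroʳ c))
all-not-∧-any c p (x ∷ xs) = trans (cong (not (c ∧ p x) ∧_) (all-not-∧-any c p xs)) (deMorgan c (p x) _)
  where
  deMorgan : ∀ c a b → not (c ∧ a) ∧ not (c ∧ b) ≡ not (c ∧ (a ∨ b))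
  deMorgan false _     _ = refl
  deMorgan true  false _ = refl
  deMorgan true  true  _ = refl

T-all-allFin : ∀ {n} (p : Fin n → Bool) → T (all p (allFin n)) ⇔ (∀ i → T (p i))
T-all-allFin p = mk⇔ (λ h → All.tabulate⁻ (all⁺ p _ h)) (λ h → all⁻ p (All.tabulate⁺ h))

T-any-allFin : ∀ {n} (p : Fin n → Bool) → T (any p (allFin n)) ⇔ ∃ λ i → T (p i)
T-any-allFin p = mk⇔ (λ h → Any.tabulate⁻ (any⁻ p _ h)) (λ (i , pᵢ) → any⁺ p (Any.tabulate⁺ i pᵢ))

tabulate-toℕ : ∀ (f : ℕ → A) n → tabulate {n = n} (f ∘ toℕ) ≡ applyUpTo f n
tabulate-toℕ f zero    = refl
tabulate-toℕ f (suc n) = cong (f 0 ∷_) (tabulate-toℕ (f ∘ suc) n)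

map-allFin-toℕ : ∀ (f : ℕ → A) n → map (f ∘ toℕ) (allFin n) ≡ map f (upTo n)
map-allFin-toℕ f n = trans (map-tabulate id (f ∘ toℕ)) (trans (tabulate-toℕ f n) (sym (map-upTo f n)))

all-allFin-toℕ : ∀ (p : ℕ → Bool) n → all (p ∘ toℕ) (allFin n) ≡ all p (upTo n)
all-allFin-toℕ p n = cong and (map-allFin-toℕ p n)

any-allFin-toℕ : ∀ (p : ℕ → Bool) n → any (p ∘ toℕ) (allFin n) ≡ any p (upTo n)
any-allFin-toℕ p n = cong or (map-allFin-toℕ p n)

any-upTo-∈ : ∀ (s : ℕ → Bool) N l → (∀ y → T (s y) → y < N) →
             any (λ y → s y ∧ any (y ≡ᵇ_) l) (upTo N) ≡ any s l
any-upTo-∈ s N l bounded = T-ext to from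
  where
  to : T (any (λ y → s y ∧ any (y ≡ᵇ_) l) (upTo N)) → T (any s l)
  to h with y , sy∧y∈l ← Any.satisfied (any⁻ _ (upTo N) h) with sy , y∈l ← Equivalence.to T-∧ sy∧y∈l =
    any⁺ s (Any.map (λ {z} y≡z → subst (T ∘ s) (≡ᵇ⇒≡ y z y≡z) sy) (any⁻ _ l y∈l))
  from : T (any s l) → T (any (λ y → s y ∧ any (y ≡ᵇ_) l) (upTo N))
  from h with y , y∈l , sy ← find (any⁻ s l h) =
    any⁺ _ (lose (∈-upTo⁺ (bounded y sy))
      (Equivalence.from T-∧ (sy , any⁺ _ (lose y∈l (≡⇒≡ᵇ y y refl)))))

count : (A → Bool) → List A → ℕ
count p xs = length (filter (T? ∘ p) xs)

count-cong : ∀ {p q : A → Bool} → (∀ x → p x ≡ q x) → ∀ xs → count p xs ≡ count q xs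
count-cong p≗q xs =
  cong length (filter-≐ (T? ∘ _) (T? ∘ _) ((λ {x} → subst T (p≗q x)) , (λ {x} → subst T (sym (p≗q x)))) xs)

count-++ : ∀ (p : A → Bool) xs ys → count p (xs ++ ys) ≡ count p xs + count p ys
count-++ p xs ys = trans (cong length (filter-++ (T? ∘ p) xs ys)) (length-++ (filter (T? ∘ p) xs))

count-map : ∀ (p : B → Bool) (f : A → B) xs → count p (map f xs) ≡ count (p ∘ f) xs
count-map p f [] = refl
count-map p f (x ∷ xs) with p (f x)
... | true  = cong suc (count-map p f xs)
... | false = count-map p f xs

count-∧ : ∀ c (p : A → Bool) xs → count (λ x → c ∧ p x) xs ≡ (if c then count p xs else 0)
count-∧ true  p xs       = refl
count-∧ false p []       = refl
count-∧ false p (_ ∷ xs) = count-∧ false p xs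

infixr 5 _◂_
_◂_ : Bool → (ℕ → Bool) → ℕ → Bool
(b ◂ s) zero    = b
(b ◂ s) (suc i) = s i

indicator : ∀ {k} → Subset k → ℕ → Bool
indicator Vec.[]       = λ _ → false
indicator (b Vec.∷ S) = b ◂ indicator S

indicator-lookup : ∀ {k} (S : Subset k) u → indicator S (toℕ u) ≡ lookup S u
indicator-lookup (b Vec.∷ S) Fin.zero    = refl
indicator-lookup (b Vec.∷ S) (Fin.suc u) = indicator-lookup S u

indicator-bounded : ∀ {k} (S : Subset k) y → T (indicator S y) → y < k
indicator-bounded (b Vec.∷ S) zero    _  = s≤s z≤n
indicator-bounded (b Vec.∷ S) (suc y) Sy = s≤s (indicator-bounded S y Sy)

Σ𝔹 : (Bool → ℕ) → ℕ
Σ𝔹 f = f false + f true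

Σ𝔹-cong : ∀ {f g : Bool → ℕ} → (∀ b → f b ≡ g b) → Σ𝔹 f ≡ Σ𝔹 g
Σ𝔹-cong f≗g = cong₂ _+_ (f≗g false) (f≗g true)

countSubsets : ℕ → ((ℕ → Bool) → Bool) → ℕ
countSubsets k G = count (G ∘ indicator) (allSubsets k)

countSubsets-cong : ∀ k {G H} → (∀ s → G s ≡ H s) → countSubsets k G ≡ countSubsets k H
countSubsets-cong k G≗H = count-cong (G≗H ∘ indicator) (allSubsets k)

countSubsets-∧ : ∀ k c G → countSubsets k (λ s → c ∧ G s) ≡ (if c then countSubsets k G else 0)
countSubsets-∧ k c G = count-∧ c (G ∘ indicator) (allSubsets k)

countSubsets-suc : ∀ k G → countSubsets (suc k) G ≡ Σ𝔹 λ b → countSubsets k (λ s → G (b ◂ s))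
countSubsets-suc k G = trans (count-++ _ (map (false Vec.∷_) (allSubsets k)) _)
  (cong₂ _+_ (count-map _ (false Vec.∷_) (allSubsets k)) (count-map _ (true Vec.∷_) (allSubsets k)))

countSubsets-4+ : ∀ k G → countSubsets (4 + k) G ≡
  Σ𝔹 λ b₁ → Σ𝔹 λ b₂ → Σ𝔹 λ b₃ → Σ𝔹 λ b₄ → countSubsets k (λ s → G (b₁ ◂ b₂ ◂ b₃ ◂ b₄ ◂ s))
countSubsets-4+ k G =
  trans (countSubsets-suc (3 + k) G) (Σ𝔹-cong λ b₁ →
  trans (countSubsets-suc (2 + k) (λ s → G (b₁ ◂ s))) (Σ𝔹-cong λ b₂ →
  trans (countSubsets-suc (1 + k) (λ s → G (b₁ ◂ b₂ ◂ s))) (Σ𝔹-cong λ b₃ →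
  countSubsets-suc k (λ s → G (b₁ ◂ b₂ ◂ b₃ ◂ s)))))

-- Maximal independent sets as a local condition

module MaximalIndependentSets {N : ℕ} (adj : Fin N → Fin N → Bool)
  (adj-irrefl : ∀ u → adj u u ≡ false) (adj-sym : ∀ u v → adj u v ≡ adj v u) where

  isIndependent : Subset N → Bool
  isIndependent S =
    all (λ u → all (λ v → not (lookup S u ∧ lookup S v ∧ adj u v)) (allFin N)) (allFin N)

  isMaximalIndependent : Subset N → Bool
  isMaximalIndependent S =
    isIndependent S ∧ all (λ v → lookup S v ∨ not (isIndependent (S [ v ]≔ true))) (allFin N)

  dominated : Subset N → Fin N → Bool
  dominated S u = any (λ v → lookup S v ∧ adj u v) (allFin N)

  isIndependent≡ : ∀ S → isIndependent S ≡ all (λ u → not (lookup S u ∧ dominated S u)) (allFin N)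
  isIndependent≡ S =
    all-cong (λ u → all-not-∧-any (lookup S u) (λ v → lookup S v ∧ adj u v) (allFin N)) (allFin N)

  independent⇒ : ∀ S → T (isIndependent S) →
                 ∀ u v → T (lookup S u) → T (lookup S v) → ¬ T (adj u v)
  independent⇒ S indep u v Su Sv uv =
    nand (lookup S u) (lookup S v) (adj u v)
      (Equivalence.to (T-all-allFin _) (Equivalence.to (T-all-allFin _) indep u) v) Su Sv uv
    where
    nand : ∀ a b c → T (not (a ∧ b ∧ c)) → T a → T b → ¬ T c
    nand true true true ()

  independent⇐ : ∀ S → (∀ u v → T (lookup S u) → T (lookup S v) → ¬ T (adj u v)) →
                 T (isIndependent S)
  independent⇐ S indep =
    Equivalence.from (T-all-allFin _) λ u → Equivalence.from (T-all-allFin _) λ v →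
      nand (lookup S u) (lookup S v) (adj u v) (indep u v)
    where
    nand : ∀ a b c → (T a → T b → ¬ T c) → T (not (a ∧ b ∧ c))
    nand false _     _     _ = _
    nand true  false _     _ = _
    nand true  true  false _ = _
    nand true  true  true  h = h _ _ _

  dominated⇒ : ∀ S {u} → T (dominated S u) → ∃ λ v → T (lookup S v) × T (adj u v)
  dominated⇒ S h with v , Sv∧uv ← Equivalence.to (T-any-allFin _) h =
    v , Equivalence.to T-∧ Sv∧uv

  dominated⇐ : ∀ S {u} v → T (lookup S v) → T (adj u v) → T (dominated S u)
  dominated⇐ S v Sv uv = Equivalence.from (T-any-allFin _) (v , Equivalence.from T-∧ (Sv , uv))

  not-isIndependent-insert : ∀ S → T (isIndependent S) →
                             ∀ v → not (isIndependent (S [ v ]≔ true)) ≡ dominated S v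
  not-isIndependent-insert S indep v = T-ext-not independent-if-undominated not-independent-if-dominated
    where
    S′ = S [ v ]≔ true
    S′v : T (lookup S′ v)
    S′v = subst T (sym (lookup∘update v S true)) _
    S⊆S′ : ∀ w → T (lookup S w) → T (lookup S′ w)
    S⊆S′ w Sw with w ≟ v
    ... | yes refl = S′v
    ... | no w≢v   = subst T (sym (lookup∘update′ w≢v S true)) Sw
    S′-S : ∀ {w} → w ≢ v → T (lookup S′ w) → T (lookup S w)
    S′-S w≢v = subst T (lookup∘update′ w≢v S true)

    not-independent-if-dominated : T (dominated S v) → ¬ T (isIndependent S′)
    not-independent-if-dominated d indep′ with w , Sw , vw ← dominated⇒ S d =
      independent⇒ S′ indep′ v w S′v (S⊆S′ w Sw) vw

    independent-if-undominated : ¬ T (dominated S v) → T (isIndependent S′)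
    independent-if-undominated undominated = independent⇐ S′ edgeless
      where
      edgeless : ∀ u w → T (lookup S′ u) → T (lookup S′ w) → ¬ T (adj u w)
      edgeless u w S′u S′w uw with u ≟ v | w ≟ v
      ... | yes refl | yes refl = subst T (adj-irrefl u) uw
      ... | yes refl | no w≢v   = undominated (dominated⇐ S w (S′-S w≢v S′w) uw)
      ... | no u≢v   | yes refl = undominated (dominated⇐ S u (S′-S u≢v S′u) (subst T (adj-sym u w) uw))
      ... | no u≢v   | no w≢v   = independent⇒ S indep u w (S′-S u≢v S′u) (S′-S w≢v S′w) uw

  isMaximalIndependent≡ : ∀ S →
    isMaximalIndependent S ≡ all (λ u → lookup S u xor dominated S u) (allFin N)
  isMaximalIndependent≡ S = begin
    isIndependent S ∧ all (λ v → inS v ∨ not (isIndependent (S [ v ]≔ true))) (allFin N)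
      ≡⟨ ∧-cong-assuming (isIndependent S) (λ indep →
           all-cong (λ v → cong (inS v ∨_) (not-isIndependent-insert S indep v)) (allFin N)) ⟩
    isIndependent S ∧ all (λ u → inS u ∨ dominated S u) (allFin N)
      ≡⟨ cong (_∧ all (λ u → inS u ∨ dominated S u) (allFin N)) (isIndependent≡ S) ⟩
    all (λ u → not (inS u ∧ dominated S u)) (allFin N) ∧ all (λ u → inS u ∨ dominated S u) (allFin N)
      ≡⟨ ∧-comm (all (λ u → not (inS u ∧ dominated S u)) (allFin N)) _ ⟩
    all (λ u → inS u ∨ dominated S u) (allFin N) ∧ all (λ u → not (inS u ∧ dominated S u)) (allFin N)
      ≡⟨ sym (all-∧ _ _ (allFin N)) ⟩
    all (λ u → (inS u ∨ dominated S u) ∧ not (inS u ∧ dominated S u)) (allFin N)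
      ≡⟨ all-cong (λ u → sym (xor-is-ok (inS u) (dominated S u))) (allFin N) ⟩
    all (λ u → inS u xor dominated S u) (allFin N)
      ∎
    where
    open ≡-Reasoning
    inS = lookup S

-- Linear recurrences

module LinearRecurrence (a b c q : ℕ → ℕ)
  (a-suc : ∀ k → a (suc k) ≡ 2 * b k + c k)
  (b-suc : ∀ k → b (suc k) ≡ 2 * c k)
  (c-suc : ∀ k → c (suc k) ≡ a k + 2 * b k + c k)
  (q≡a+b : ∀ k → q k ≡ a k + b k) where

  q-1+ : ∀ k → q (suc k) ≡ 2 * b k + 3 * c k
  q-1+ k rewrite q≡a+b (suc k) | a-suc k | b-suc k = lem (b k) (c k)
    where lem : ∀ y z → 2 * y + z + 2 * z ≡ 2 * y + 3 * z
          lem = solve-∀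

  q-2+ : ∀ k → q (suc (suc k)) ≡ 3 * a k + 6 * b k + 7 * c k
  q-2+ k rewrite q-1+ (suc k) | b-suc k | c-suc k = lem (a k) (b k) (c k)
    where lem : ∀ x y z → 2 * (2 * z) + 3 * (x + 2 * y + z) ≡ 3 * x + 6 * y + 7 * z
          lem = solve-∀

  q-3+ : ∀ k → q (suc (suc (suc k))) ≡ 7 * a k + 20 * b k + 22 * c k
  q-3+ k rewrite q-2+ (suc k) | a-suc k | b-suc k | c-suc k = lem (a k) (b k) (c k)
    where lem : ∀ x y z → 3 * (2 * y + z) + 6 * (2 * z) + 7 * (x + 2 * y + z) ≡ 7 * x + 20 * y + 22 * z
          lem = solve-∀

  q-3+-recurrence : ∀ k → q (suc (suc (suc k))) ≡ q (suc (suc k)) + 5 * q (suc k) + 4 * q k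
  q-3+-recurrence k rewrite q-3+ k | q-2+ k | q-1+ k | q≡a+b k = lem (a k) (b k) (c k)
    where lem : ∀ x y z → 7 * x + 20 * y + 22 * z ≡ 3 * x + 6 * y + 7 * z + 5 * (2 * y + 3 * z) + 4 * (x + y)
          lem = solve-∀

  q-recurrence : ∀ n → 3 ≤ n → q n ≡ q (n ∸ 1) + 5 * q (n ∸ 2) + 4 * q (n ∸ 3)
  q-recurrence _ (s≤s (s≤s (s≤s {n = k} z≤n))) = q-3+-recurrence k

  -- Stated at literal indices: comparing an instance such as p (suc 0) with p 1 would make
  -- the type checker unfold p, i.e. enumerate all subsets.
  q-initial : q 1 ≡ 2 * b 0 + 3 * c 0 × q 2 ≡ 3 * a 0 + 6 * b 0 + 7 * c 0 ×
              q 3 ≡ 7 * a 0 + 20 * b 0 + 22 * c 0 × q 4 ≡ 22 * a 0 + 58 * b 0 + 69 * c 0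
  q-initial = q-1+ 0 , q-2+ 0 , q-3+ 0 , q₄
    where
    q₄ : q 4 ≡ 22 * a 0 + 58 * b 0 + 69 * c 0
    q₄ rewrite q-3+ 1 | a-suc 0 | b-suc 0 | c-suc 0 = lem (a 0) (b 0) (c 0)
      where lem : ∀ x y z → 7 * (2 * y + z) + 20 * (2 * z) + 22 * (x + 2 * y + z) ≡ 22 * x + 58 * y + 69 * z
            lem = solve-∀

-- The pentagonal cactus

≡ᵇ-4+ : ∀ a x → (4 + a ≡ᵇ x) ≡ (4 ≤ᵇ x) ∧ (a ≡ᵇ x ∸ 4)
≡ᵇ-4+ a 0 = refl
≡ᵇ-4+ a 1 = refl
≡ᵇ-4+ a 2 = refl
≡ᵇ-4+ a 3 = refl
≡ᵇ-4+ a (suc (suc (suc (suc x)))) = refl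

sameEdge-4+ : ∀ a b x y →
  sameEdge (4 + a) (4 + b) x y ≡ (4 ≤ᵇ x) ∧ (4 ≤ᵇ y) ∧ sameEdge a b (x ∸ 4) (y ∸ 4)
sameEdge-4+ a b x y =
  trans (cong₂ _∨_ (cong₂ _∧_ (≡ᵇ-4+ a x) (≡ᵇ-4+ b y)) (cong₂ _∧_ (≡ᵇ-4+ a y) (≡ᵇ-4+ b x)))
        (factor (4 ≤ᵇ x) (4 ≤ᵇ y) _ _ _ _)
  where
  open ∨-∧-Solver
  factor : ∀ X Y p q r s → ((X ∧ p) ∧ (Y ∧ q)) ∨ ((Y ∧ r) ∧ (X ∧ s)) ≡ X ∧ Y ∧ ((p ∧ q) ∨ (r ∧ s))
  factor = solve 6 (λ X Y p q r s →
    ((X :* p) :* (Y :* q)) :+ ((Y :* r) :* (X :* s)) := X :* (Y :* ((p :* q) :+ (r :* s)))) refl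

pentagonAt : ℕ → ℕ → ℕ → Bool
pentagonAt a x y =
  sameEdge a (a + 4) x y ∨
  sameEdge (a + 4) (a + 1) x y ∨
  sameEdge (a + 1) (a + 2) x y ∨
  sameEdge (a + 2) (a + 3) x y ∨
  sameEdge (a + 3) a x y

inCycle-suc : ∀ i x y → inCycle (suc i) x y ≡ (4 ≤ᵇ x) ∧ (4 ≤ᵇ y) ∧ inCycle i (x ∸ 4) (y ∸ 4)
inCycle-suc i x y = begin
  pentagonAt (4 * suc i) x y
    ≡⟨ cong (λ a → pentagonAt a x y) (*-suc 4 i) ⟩
  pentagonAt (4 + a) x y
    ≡⟨ cong₂ _∨_ (sameEdge-4+ a (a + 4) x y)
       (cong₂ _∨_ (sameEdge-4+ (a + 4) (a + 1) x y)
       (cong₂ _∨_ (sameEdge-4+ (a + 1) (a + 2) x y)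
       (cong₂ _∨_ (sameEdge-4+ (a + 2) (a + 3) x y) (sameEdge-4+ (a + 3) a x y)))) ⟩
  _
    ≡⟨ factor (4 ≤ᵇ x) (4 ≤ᵇ y) _ _ _ _ _ ⟩
  (4 ≤ᵇ x) ∧ (4 ≤ᵇ y) ∧ pentagonAt a (x ∸ 4) (y ∸ 4)
    ∎
  where
  open ≡-Reasoning
  open ∨-∧-Solver
  a = 4 * i
  factor : ∀ X Y p q r s t → (X ∧ Y ∧ p) ∨ (X ∧ Y ∧ q) ∨ (X ∧ Y ∧ r) ∨ (X ∧ Y ∧ s) ∨ (X ∧ Y ∧ t)
                            ≡ X ∧ Y ∧ (p ∨ q ∨ r ∨ s ∨ t)
  factor = solve 7 (λ X Y p q r s t →
    (X :* (Y :* p)) :+ ((X :* (Y :* q)) :+ ((X :* (Y :* r)) :+ ((X :* (Y :* s)) :+ (X :* (Y :* t)))))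
    := X :* (Y :* (p :+ (q :+ (r :+ (s :+ t)))))) refl

adjℕ : ℕ → ℕ → ℕ → Bool
adjℕ n x y = any (λ i → inCycle i x y) (upTo n)

adjℕ-suc : ∀ n x y →
  adjℕ (suc n) x y ≡ inCycle 0 x y ∨ ((4 ≤ᵇ x) ∧ (4 ≤ᵇ y) ∧ adjℕ n (x ∸ 4) (y ∸ 4))
adjℕ-suc n x y = cong (inCycle 0 x y ∨_) (begin
  any (λ i → inCycle i x y) (applyUpTo suc n)
    ≡⟨ any-applyUpTo _ suc n ⟩
  any (λ i → inCycle (suc i) x y) (upTo n)
    ≡⟨ any-cong (λ i → inCycle-suc i x y) (upTo n) ⟩
  any (λ i → (4 ≤ᵇ x) ∧ (4 ≤ᵇ y) ∧ inCycle i x′ y′) (upTo n)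
    ≡⟨ any-∧ˡ (4 ≤ᵇ x) _ (upTo n) ⟩
  (4 ≤ᵇ x) ∧ any (λ i → (4 ≤ᵇ y) ∧ inCycle i x′ y′) (upTo n)
    ≡⟨ cong ((4 ≤ᵇ x) ∧_) (any-∧ˡ (4 ≤ᵇ y) _ (upTo n)) ⟩
  (4 ≤ᵇ x) ∧ (4 ≤ᵇ y) ∧ adjℕ n x′ y′
    ∎)
  where
  open ≡-Reasoning
  x′ = x ∸ 4
  y′ = y ∸ 4

nbrs : ℕ → ℕ → List ℕ
nbrs zero    _ = []
nbrs (suc n) 0 = 4 ∷ 3 ∷ []
nbrs (suc n) 1 = 4 ∷ 2 ∷ []
nbrs (suc n) 2 = 1 ∷ 3 ∷ []
nbrs (suc n) 3 = 2 ∷ 0 ∷ []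
nbrs (suc n) 4 = 0 ∷ 1 ∷ map (4 +_) (nbrs n 0)
nbrs (suc n) (suc (suc (suc (suc (suc x))))) = map (4 +_) (nbrs n (suc x))

adjℕ≡nbrs : ∀ n x y → adjℕ n x y ≡ any (y ≡ᵇ_) (nbrs n x)
adjℕ≡nbrs zero    x y = refl
adjℕ≡nbrs (suc n) x y = trans (adjℕ-suc n x y) (table x y)
  where
  shifted : ∀ x y → adjℕ n x y ≡ any (4 + y ≡ᵇ_) (map (4 +_) (nbrs n x))
  shifted x y = trans (adjℕ≡nbrs n x y) (sym (any-map _ (4 +_) (nbrs n x)))
  below4 : ∀ y l → (∀ z → (y ≡ᵇ 4 + z) ≡ false) → false ≡ any (y ≡ᵇ_) (map (4 +_) l)
  below4 y l never = sym (trans (any-map _ (4 +_) l) (trans (any-cong never l) (any-false l)))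
  -- inCycle 0 x y only computes once x and y are each known to be 0, 1, 2, 3, 4 or ≥ 5.
  table : ∀ x y → inCycle 0 x y ∨ ((4 ≤ᵇ x) ∧ (4 ≤ᵇ y) ∧ adjℕ n (x ∸ 4) (y ∸ 4))
                ≡ any (y ≡ᵇ_) (nbrs (suc n) x)
  table 0 0 = refl
  table 0 1 = refl
  table 0 2 = refl
  table 0 3 = refl
  table 0 4 = refl
  table 0 (suc (suc (suc (suc (suc y))))) = refl
  table 1 0 = refl
  table 1 1 = refl
  table 1 2 = refl
  table 1 3 = refl
  table 1 4 = refl
  table 1 (suc (suc (suc (suc (suc y))))) = refl
  table 2 0 = refl
  table 2 1 = refl
  table 2 2 = refl
  table 2 3 = refl
  table 2 4 = refl
  table 2 (suc (suc (suc (suc (suc y))))) = refl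
  table 3 0 = refl
  table 3 1 = refl
  table 3 2 = refl
  table 3 3 = refl
  table 3 4 = refl
  table 3 (suc (suc (suc (suc (suc y))))) = refl
  table 4 0 = refl
  table 4 1 = refl
  table 4 2 = below4 2 (nbrs n 0) λ _ → refl
  table 4 3 = below4 3 (nbrs n 0) λ _ → refl
  table 4 4 = shifted 0 0
  table 4 (suc (suc (suc (suc (suc y))))) = shifted 0 (suc y)
  table (suc (suc (suc (suc (suc x))))) 0 = below4 0 (nbrs n (suc x)) λ _ → refl
  table (suc (suc (suc (suc (suc x))))) 1 = below4 1 (nbrs n (suc x)) λ _ → refl
  table (suc (suc (suc (suc (suc x))))) 2 = below4 2 (nbrs n (suc x)) λ _ → refl
  table (suc (suc (suc (suc (suc x))))) 3 = below4 3 (nbrs n (suc x)) λ _ → refl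
  table (suc (suc (suc (suc (suc x))))) 4 = shifted (suc x) 0
  table (suc (suc (suc (suc (suc x))))) (suc (suc (suc (suc (suc y))))) = shifted (suc x) (suc y)

adjℕ-irrefl : ∀ n x → adjℕ n x x ≡ false
adjℕ-irrefl zero    x = refl
adjℕ-irrefl (suc n) x = trans (adjℕ-suc n x x) (go x)
  where
  go : ∀ x → inCycle 0 x x ∨ ((4 ≤ᵇ x) ∧ (4 ≤ᵇ x) ∧ adjℕ n (x ∸ 4) (x ∸ 4)) ≡ false
  go 0 = refl
  go 1 = refl
  go 2 = refl
  go 3 = refl
  go 4 = adjℕ-irrefl n 0
  go (suc (suc (suc (suc (suc x))))) = adjℕ-irrefl n (suc x)

adjℕ-sym : ∀ n x y → adjℕ n x y ≡ adjℕ n y x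
adjℕ-sym n x y = any-cong (λ i → pentagon-sym (4 * i)) (upTo n)
  where
  sameEdge-sym : ∀ a b → sameEdge a b x y ≡ sameEdge a b y x
  sameEdge-sym a b = ∨-comm ((a ≡ᵇ x) ∧ (b ≡ᵇ y)) ((a ≡ᵇ y) ∧ (b ≡ᵇ x))
  pentagon-sym : ∀ a → pentagonAt a x y ≡ pentagonAt a y x
  pentagon-sym a =
    cong₂ _∨_ (sameEdge-sym a (a + 4)) (cong₂ _∨_ (sameEdge-sym (a + 4) (a + 1))
    (cong₂ _∨_ (sameEdge-sym (a + 1) (a + 2))
    (cong₂ _∨_ (sameEdge-sym (a + 2) (a + 3)) (sameEdge-sym (a + 3) a))))

-- The transfer matrix

-- Defs.independent and Defs.maximalIndependent are definitionally the generic notions at adj n.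
module Cactus (n : ℕ) = MaximalIndependentSets (adj n)
  (λ u → adjℕ-irrefl n (toℕ u)) (λ u v → adjℕ-sym n (toℕ u) (toℕ v))

-- e records whether vertex 0 already has a neighbour in the set outside P(n).
isMIS : ℕ → Bool → (ℕ → Bool) → Bool
isMIS n e s = all (λ x → s x xor (((x ≡ᵇ 0) ∧ e) ∨ any s (nbrs n x))) (upTo (nV n))

dominated≡any-nbrs : ∀ n (S : Subset (nV n)) u →
  Cactus.dominated n S u ≡ any (indicator S) (nbrs n (toℕ u))
dominated≡any-nbrs n S u = begin
  any (λ v → lookup S v ∧ adjℕ n x (toℕ v)) (allFin N)
    ≡⟨ any-cong (λ v → cong (_∧ adjℕ n x (toℕ v)) (sym (indicator-lookup S v))) (allFin N) ⟩
  any (λ v → s (toℕ v) ∧ adjℕ n x (toℕ v)) (allFin N)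
    ≡⟨ any-allFin-toℕ (λ y → s y ∧ adjℕ n x y) N ⟩
  any (λ y → s y ∧ adjℕ n x y) (upTo N)
    ≡⟨ any-cong (λ y → cong (s y ∧_) (adjℕ≡nbrs n x y)) (upTo N) ⟩
  any (λ y → s y ∧ any (y ≡ᵇ_) (nbrs n x)) (upTo N)
    ≡⟨ any-upTo-∈ s N (nbrs n x) (indicator-bounded S) ⟩
  any s (nbrs n x)
    ∎
  where
  open ≡-Reasoning
  N = nV n
  s = indicator S
  x = toℕ u

maximalIndependent≡isMIS : ∀ n S → maximalIndependent n S ≡ isMIS n false (indicator S)
maximalIndependent≡isMIS n S = begin
  maximalIndependent n S
    ≡⟨ Cactus.isMaximalIndependent≡ n S ⟩
  all (λ u → lookup S u xor Cactus.dominated n S u) (allFin N)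
    ≡⟨ all-cong (λ u → cong₂ _xor_ (sym (indicator-lookup S u)) (dominated≡any-nbrs n S u)) (allFin N) ⟩
  all (λ u → s (toℕ u) xor any s (nbrs n (toℕ u))) (allFin N)
    ≡⟨ all-allFin-toℕ (λ x → s x xor any s (nbrs n x)) N ⟩
  all (λ x → s x xor any s (nbrs n x)) (upTo N)
    ≡⟨ all-cong (λ x → cong (λ b → s x xor (b ∨ any s (nbrs n x))) (sym (∧-zeroʳ (x ≡ᵇ 0)))) (upTo N) ⟩
  isMIS n false s
    ∎
  where
  open ≡-Reasoning
  N = nV n
  s = indicator S

firstPentagonOK : Bool → Bool → Bool → Bool → Bool → Bool → Bool
firstPentagonOK e b₀ b₁ b₂ b₃ b₄ =
  (b₀ xor (e ∨ b₄ ∨ b₃)) ∧ (b₁ xor (b₄ ∨ b₂)) ∧ (b₂ xor (b₁ ∨ b₃)) ∧ (b₃ xor (b₂ ∨ b₀))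

nV-suc : ∀ n → nV (suc n) ≡ 4 + nV n
nV-suc n = cong (_+ 1) (*-suc 4 n)

isMIS-suc : ∀ n e s →
  isMIS (suc n) e s ≡ firstPentagonOK e (s 0) (s 1) (s 2) (s 3) (s 4) ∧ isMIS n (s 0 ∨ s 1) (s ∘ (4 +_))
isMIS-suc n e s = begin
  all c (upTo (nV (suc n)))
    ≡⟨ cong (all c ∘ upTo) (nV-suc n) ⟩
  c 0 ∧ c 1 ∧ c 2 ∧ c 3 ∧ all c (applyUpTo (4 +_) (nV n))
    ≡⟨ cong (λ r → c 0 ∧ c 1 ∧ c 2 ∧ c 3 ∧ r)
         (trans (all-applyUpTo c (4 +_) (nV n)) (all-cong tail (upTo (nV n)))) ⟩
  c 0 ∧ c 1 ∧ c 2 ∧ c 3 ∧ isMIS n (s 0 ∨ s 1) (s ∘ (4 +_))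
    ≡⟨ head e (s 0) (s 1) (s 2) (s 3) (s 4) _ ⟩
  firstPentagonOK e (s 0) (s 1) (s 2) (s 3) (s 4) ∧ isMIS n (s 0 ∨ s 1) (s ∘ (4 +_))
    ∎
  where
  open ≡-Reasoning
  c : ℕ → Bool
  c x = s x xor (((x ≡ᵇ 0) ∧ e) ∨ any s (nbrs (suc n) x))
  tail : ∀ x → c (4 + x) ≡ s (4 + x) xor (((x ≡ᵇ 0) ∧ (s 0 ∨ s 1)) ∨ any (s ∘ (4 +_)) (nbrs n x))
  tail 0       = cong (s 4 xor_) (trans (cong (λ r → s 0 ∨ s 1 ∨ r) (any-map s (4 +_) (nbrs n 0)))
                                        (sym (∨-assoc (s 0) (s 1) _)))
  tail (suc x) = cong (s (5 + x) xor_) (any-map s (4 +_) (nbrs n (suc x)))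
  head : ∀ e b₀ b₁ b₂ b₃ b₄ r →
    (b₀ xor (e ∨ b₄ ∨ b₃ ∨ false)) ∧ (b₁ xor (b₄ ∨ b₂ ∨ false)) ∧
    (b₂ xor (b₁ ∨ b₃ ∨ false)) ∧ (b₃ xor (b₂ ∨ b₀ ∨ false)) ∧ r
    ≡ firstPentagonOK e b₀ b₁ b₂ b₃ b₄ ∧ r
  head e b₀ b₁ b₂ b₃ b₄ r rewrite ∨-identityʳ b₀ | ∨-identityʳ b₂ | ∨-identityʳ b₃ =
    sym (∧-assoc₄ (b₀ xor (e ∨ b₄ ∨ b₃)) (b₁ xor (b₄ ∨ b₂)) (b₂ xor (b₁ ∨ b₃)) (b₃ xor (b₂ ∨ b₀)) r)

-- The states a, b, c of the proof idea are (e, s 0) = (false, false), (false, true), (true, false).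
misCount : ℕ → Bool → Bool → ℕ
misCount n e b = countSubsets (4 * n) (λ s → isMIS n e (b ◂ s))

p≡misCount : ∀ n → p n ≡ misCount n false false + misCount n false true
p≡misCount n = begin
  count (maximalIndependent n) (allSubsets (nV n))
    ≡⟨ count-cong (maximalIndependent≡isMIS n) (allSubsets (nV n)) ⟩
  countSubsets (nV n) (isMIS n false)
    ≡⟨ cong (λ k → countSubsets k (isMIS n false)) (+-comm (4 * n) 1) ⟩
  countSubsets (suc (4 * n)) (isMIS n false)
    ≡⟨ countSubsets-suc (4 * n) (isMIS n false) ⟩
  misCount n false false + misCount n false true
    ∎
  where open ≡-Reasoning

misCount-suc : ∀ n e b₀ → misCount (suc n) e b₀ ≡
  Σ𝔹 λ b₁ → Σ𝔹 λ b₂ → Σ𝔹 λ b₃ → Σ𝔹 λ b₄ →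
    if firstPentagonOK e b₀ b₁ b₂ b₃ b₄ then misCount n (b₀ ∨ b₁) b₄ else 0
misCount-suc n e b₀ = begin
  countSubsets (4 * suc n) (λ s → isMIS (suc n) e (b₀ ◂ s))
    ≡⟨ cong (λ k → countSubsets k (λ s → isMIS (suc n) e (b₀ ◂ s))) (*-suc 4 n) ⟩
  countSubsets (4 + 4 * n) (λ s → isMIS (suc n) e (b₀ ◂ s))
    ≡⟨ countSubsets-4+ (4 * n) (λ s → isMIS (suc n) e (b₀ ◂ s)) ⟩
  (Σ𝔹 λ b₁ → Σ𝔹 λ b₂ → Σ𝔹 λ b₃ → Σ𝔹 λ b₄ →
    countSubsets (4 * n) (λ s → isMIS (suc n) e (b₀ ◂ b₁ ◂ b₂ ◂ b₃ ◂ b₄ ◂ s)))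
    ≡⟨ (Σ𝔹-cong λ b₁ → Σ𝔹-cong λ b₂ → Σ𝔹-cong λ b₃ → Σ𝔹-cong λ b₄ →
         trans (countSubsets-cong (4 * n) (isMIS-suc n e ∘ (λ s → b₀ ◂ b₁ ◂ b₂ ◂ b₃ ◂ b₄ ◂ s)))
               (countSubsets-∧ (4 * n) (firstPentagonOK e b₀ b₁ b₂ b₃ b₄) (λ s → isMIS n (b₀ ∨ b₁) (b₄ ◂ s)))) ⟩
  (Σ𝔹 λ b₁ → Σ𝔹 λ b₂ → Σ𝔹 λ b₃ → Σ𝔹 λ b₄ →
    if firstPentagonOK e b₀ b₁ b₂ b₃ b₄ then misCount n (b₀ ∨ b₁) b₄ else 0)
    ∎
  where open ≡-Reasoning

-- Each left-hand side below is what the sum in misCount-suc evaluates to.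
misCount-ff : ∀ n → misCount (suc n) false false ≡ 2 * misCount n false true + misCount n true false
misCount-ff n = trans (misCount-suc n false false) (lem (misCount n false true) (misCount n true false))
  where lem : ∀ b c → b + (b + 0) + (c + 0 + 0) ≡ 2 * b + c
        lem = solve-∀

misCount-ft : ∀ n → misCount (suc n) false true ≡ 2 * misCount n true false
misCount-ft n = trans (misCount-suc n false true) (lem (misCount n true false))
  where lem : ∀ c → c + 0 + 0 + (c + 0 + 0 + 0) ≡ 2 * c
        lem = solve-∀

misCount-tf : ∀ n → misCount (suc n) true false ≡
                    misCount n false false + 2 * misCount n false true + misCount n true false
misCount-tf n = trans (misCount-suc n true false)
                      (lem (misCount n false false) (misCount n false true) (misCount n true false))
  where lem : ∀ a b c → b + (a + b + 0) + (c + 0 + 0) ≡ a + 2 * b + c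
        lem = solve-∀

open LinearRecurrence (λ n → misCount n false false) (λ n → misCount n false true)
  (λ n → misCount n true false) p misCount-ff misCount-ft misCount-tf p≡misCount

theorem2p10 : p 1 ≡ 5 × p 2 ≡ 13 × p 3 ≡ 42 × p 4 ≡ 127 ×
    ((n : ℕ) → 5 ≤ n → p n ≡ p (n ∸ 1) + 5 * p (n ∸ 2) + 4 * p (n ∸ 3))
theorem2p10 =
  let p₁ , p₂ , p₃ , p₄ = q-initial in
  trans p₁ refl , trans p₂ refl , trans p₃ refl , trans p₄ refl ,
  λ n 5≤n → q-recurrence n (≤-trans (s≤s (s≤s (s≤s z≤n))) 5≤n)
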